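{- Let $F$ be a semi-skyline augmented filling of shape $\gamma$. Let $a=(i_1,j)$, $c=(i_2,j)$ and $b=(i_2,j+1)$ be cells of the augmented diagram of $\gamma$ with $j\ge 0$, $i_1<i_2$ and $\gamma_{i_2}>\gamma_{i_1}$ (so $\{a,c,b\}$ is a type B triple, with $b$ directly above $c$). Then $F(a)<F(c)$.
   Context: A weak composition is a sequence $\gamma=(\gamma_1,\gamma_2,\dots)$ of nonnegative integers (finitely or infinitely many parts, finitely many nonzero). The augmented diagram of $\gamma$ consists of the cells $(i,j)$ with $i$ a column index of $\gamma$ and $0\le j\le\gamma_i$; row $0$ is the basement, and column $i$ has height $\gamma_i$. An augmented filling $F$ assigns a positive integer $F(c)$ to each cell $c$, with $F(i,0)=i$ for every basement cell. A descent is a pair of cells $(i,j+1),(i,j)$ with $F(i,j+1)>F(i,j)$. Let $I(x,y)=1$ if $x>y$ and $0$ otherwise. A type A triple consists of cells $a_1=(i_1,j)$, $a_2=(i_2,j)$, $a_3=(i_1,j-1)$ with $j\ge1$, $i_1<i_2$ and $\gamma_{i_1}\ge\gamma_{i_2}$; it is an inversion triple if $I(F(a_1),F(a_2))+I(F(a_2),F(a_3))-I(F(a_1),F(a_3))=1$. A type B triple consists of cells $a_1=(i_1,j)$, $a_2=(i_2,j)$, $a_3=(i_2,j+1)$ with $j\ge0$, $i_1<i_2$ and $\gamma_{i_2}>\gamma_{i_1}$; it is an inversion triple if $I(F(a_3),F(a_1))+I(F(a_1),F(a_2))-I(F(a_3),F(a_2))=1$. A semi-skyline augmented filling (SSAF)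 of shape $\gamma$ is an augmented filling of $\gamma$ with no descents in which every type A and every type B triple is an inversion triple. -}

module Defs where

open import Data.Nat using (ℕ; zero; suc; _+_; _≤_; _<_; _≥_; _>_; _<ᵇ_)
open import Data.Bool using (if_then_else_)
open import Data.Product using (_×_; ∃-syntax)
open import Relation.Binary.PropositionalEquality using (_≡_)

-- Column index sets.  Columns are numbered 1,2,3,...
-- A weak composition has either finitely many parts (columns 1..n)
-- or infinitely many parts (columns 1,2,3,...).
data Cols : Set where
  finite   : ℕ → Cols
  infinite : Cols

InCols : Cols → ℕ → Set
InCols (finite n) i = 1 ≤ i × i ≤ n
InCols infinite   i = 1 ≤ i

-- A weak composition: a column set together with the part γ i of each
-- column i (values of γ outside the column set are irrelevant), having
-- finitely many nonzero parts.
record WeakComp : Set where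
  constructor wc
  field
    cols    : Cols
    γ       : ℕ → ℕ
    finSupp : ∃[ N ] (∀ i → InCols cols i → N ≤ i → γ i ≡ 0)

open WeakComp public

Cell : WeakComp → ℕ → ℕ → Set
Cell g i j = InCols (cols g) i × j ≤ γ g i

-- A filling assigns F i j to cell (i , j); values off the diagram are irrelevant.
Filling : Set
Filling = ℕ → ℕ → ℕ

IsAugmentedFilling : WeakComp → Filling → Set
IsAugmentedFilling g F =
  (∀ i j → Cell g i j → 1 ≤ F i j) ×
  (∀ i → InCols (cols g) i → F i 0 ≡ i)

I : ℕ → ℕ → ℕ
I x y = if y <ᵇ x then 1 else 0

NoDescents : WeakComp → Filling → Set
NoDescents g F = ∀ i j → Cell g i (suc j) → Cell g i j → F i (suc j) ≤ F i j

-- Type A triple a1=(i1,j), a2=(i2,j), a3=(i1,j-1): j ≥ 1, i1 < i2, γ i1 ≥ γ i2.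
-- Written with j = suc k.  The inversion condition
--   I(a1,a2) + I(a2,a3) - I(a1,a3) = 1
-- is stated equivalently in ℕ as  I(a1,a2) + I(a2,a3) ≡ 1 + I(a1,a3).
TypeAInv : WeakComp → Filling → Set
TypeAInv g F = ∀ i₁ i₂ k →
  Cell g i₁ (suc k) → Cell g i₂ (suc k) → Cell g i₁ k →
  i₁ < i₂ → γ g i₁ ≥ γ g i₂ →
  I (F i₁ (suc k)) (F i₂ (suc k)) + I (F i₂ (suc k)) (F i₁ k)
    ≡ 1 + I (F i₁ (suc k)) (F i₁ k)

-- Type B triple a1=(i1,j), a2=(i2,j), a3=(i2,j+1): j ≥ 0, i1 < i2, γ i2 > γ i1.
-- Inversion: I(a3,a1) + I(a1,a2) - I(a3,a2) = 1.
TypeBInv : WeakComp → Filling → Set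
TypeBInv g F = ∀ i₁ i₂ j →
  Cell g i₁ j → Cell g i₂ j → Cell g i₂ (suc j) →
  i₁ < i₂ → γ g i₂ > γ g i₁ →
  I (F i₂ (suc j)) (F i₁ j) + I (F i₁ j) (F i₂ j)
    ≡ 1 + I (F i₂ (suc j)) (F i₂ j)

IsSSAF : WeakComp → Filling → Set
IsSSAF g F = IsAugmentedFilling g F × NoDescents g F × TypeAInv g F × TypeBInv g F

-- In the basement F(i,0) = i, so F(a) < F(c) is
-- i₁ < i₂.  In row j+1, the induction hypothesis F(i₁,j) < F(i₂,j) and the
-- absence of descents F(i₂,j+1) ≤ F(i₂,j) make two of the three indicators
-- of the type B triple (i₁,j), (i₂,j), (i₂,j+1) vanish, so its inversion
-- condition forces F(i₁,j) < F(i₂,j+1); no descent in column i₁ then gives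
-- F(i₁,j+1) ≤ F(i₁,j) < F(i₂,j+1).
module Submission where

open import Defs
open import Data.Nat using (ℕ; suc; zero; _<_; _>_; _≤_; _<ᵇ_; _+_)
open import Data.Nat.Properties using (<ᵇ⇒<; <⇒≱; <⇒≤; ≤-<-trans; ≤-trans; n≤1+n; +-identityʳ)
open import Data.Bool using (T; true; false)
open import Data.Product using (_,_; proj₁; proj₂)
open import Relation.Nullary using (contradiction)
open import Relation.Binary.PropositionalEquality using (_≡_; refl; subst; sym; cong; module ≡-Reasoning)

I-≤ : ∀ {x y} → x ≤ y → I x y ≡ 0
I-≤ {x} {y} x≤y with y <ᵇ x in eq
... | true  = contradiction x≤y (<⇒≱ (<ᵇ⇒< y x (subst T (sym eq) _)))
... | false = refl

I≡1⇒> : ∀ {x y} → I x y ≡ 1 → x > y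
I≡1⇒> {x} {y} h with y <ᵇ x in eq
I≡1⇒> {x} {y} refl | true = <ᵇ⇒< y x (subst T (sym eq) _)

inversion⇒< : ∀ {a b c} → I b a + I a c ≡ 1 + I b c → a < c → b ≤ c → a < b
inversion⇒< {a} {b} {c} inv a<c b≤c = I≡1⇒> (begin
  I b a          ≡⟨ sym (+-identityʳ _) ⟩
  I b a + 0      ≡⟨ cong (I b a +_) (sym (I-≤ (<⇒≤ a<c))) ⟩
  I b a + I a c  ≡⟨ inv ⟩
  1 + I b c      ≡⟨ cong (1 +_) (I-≤ b≤c) ⟩
  1              ∎)
  where open ≡-Reasoning

cell-below : ∀ g {i j} → Cell g i (suc j) → Cell g i j
cell-below _ (i∈ , j<γ) = i∈ , ≤-trans (n≤1+n _) j<γ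

lemma2p6 : (g : WeakComp) (F : Filling) → IsSSAF g F →
    ∀ i₁ i₂ j → Cell g i₁ j → Cell g i₂ j → Cell g i₂ (suc j) →
    i₁ < i₂ → γ g i₂ > γ g i₁ →
    F i₁ j < F i₂ j
lemma2p6 g F ((_ , basement) , _ , _ , _) i₁ i₂ zero a c _ i₁<i₂ _
  rewrite basement i₁ (proj₁ a) | basement i₂ (proj₁ c) = i₁<i₂
lemma2p6 g F ssaf@(_ , noDescent , _ , typeB) i₁ i₂ (suc j) a c _ i₁<i₂ γ₂>γ₁ =
  ≤-<-trans (noDescent i₁ j a a′) (inversion⇒< inv below (noDescent i₂ j c c′))
  where
  a′ = cell-below g a
  c′ = cell-below g c
  below = lemma2p6 g F ssaf i₁ i₂ j a′ c′ c i₁<i₂ γ₂>γ₁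
  inv = typeB i₁ i₂ j a′ c′ c i₁<i₂ γ₂>γ₁
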